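{- For any set $\mathbf P$ of path axioms, the proof systems $\mathbf{SKt}+\mathbf{AxP}$ (axiomatic extension) and $\mathbf{SKt}+\mathbf P$ (structural extension) are equivalent.
   Context: Formulae are in negation normal form over $a,\neg a,\lor,\land,\square,\blacksquare,\lozenge,\lozenge^{\bullet}$, where $\lozenge^{\bullet}$ is the past diamond (dual of $\blacksquare$), $\overline A$ is the nnf of $\neg A$. $\mathbf{SKt}$ is the shallow nested sequent calculus: $id$ ($\Gamma,a,\overline a$), $cut$, $\land$, $\lor$, $ctr$, $wk$, $rf$ (from $\Gamma,\circ\{\Delta\}$ infer $\bullet\{\Gamma\},\Delta$), $rp$ (from $\Gamma,\bullet\{\Delta\}$ infer $\circ\{\Gamma\},\Delta$), $\blacksquare$ (from $\Gamma,\bullet\{A\}$ infer $\Gamma,\blacksquare A$), $\square$ (from $\Gamma,\circ\{A\}$ infer $\Gamma,\square A$), $\lozenge^{\bullet}$ (from $\Gamma,\bullet\{\Delta,A\}$ infer $\Gamma,\bullet\{\Delta\},\lozenge^{\bullet}A$), $\lozenge$ (from $\Gamma,\circ\{\Delta,A\}$ infer $\Gamma,\circ\{\Delta\},\lozenge A$). A path axiom is a scheme $\langle?\rangle_1\cdots\langle?\rangle_n X\to\langle?\rangle X$ with $n\ge0$ and each $\langle?\rangle,\langle?\rangle_i\in\{\lozenge,\lozenge^{\bullet}\}$. $\mathbf{SKt}+\mathbf{AxP}$ adds, for each axiom $F\to G$ in $\mathbf P$, the premise-free rule $\overline F,G$ (all instances). $\mathbf{SKt}+\mathbf P$ adds,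 for each such axiom, the structural rule: from $\Gamma,\star\{\Delta\}$ infer $\Gamma,\star_1\{\cdots\star_n\{\Delta\}\cdots\}$, where the structural connective for $\lozenge$ is $\circ$ and for $\lozenge^{\bullet}$ is $\bullet$ (i.e. $\star$, $\star_i$ are the structural connectives corresponding to the boxes dual to $\langle?\rangle$, $\langle?\rangle_i$: $\circ$ for $\square$, $\bullet$ for $\blacksquare$). -}

module Defs where

open import Data.Nat using (ℕ)
open import Data.List using (List; []; _∷_; _++_; [_]; foldr)
open import Data.List.Relation.Binary.Permutation.Propositional using (_↭_)
open import Data.Empty using (⊥)
open import Data.Product using (_×_; Σ; ∃; _,_)
open import Relation.Binary.PropositionalEquality using (_≡_)

data Formula : Set where
  atom  : ℕ → Formula
  natom : ℕ → Formula
  _∨′_  : Formula → Formula → Formula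
  _∧′_  : Formula → Formula → Formula
  □     : Formula → Formula         -- future box
  ■     : Formula → Formula         -- past box
  ◇     : Formula → Formula
  ◆     : Formula → Formula

neg : Formula → Formula
neg (atom a)  = natom a
neg (natom a) = atom a
neg (A ∨′ B)  = neg A ∧′ neg B
neg (A ∧′ B)  = neg A ∨′ neg B
neg (□ A)     = ◇ (neg A)
neg (■ A)     = ◆ (neg A)
neg (◇ A)     = □ (neg A)
neg (◆ A)     = ■ (neg A)

-- Shallow nested sequents: a sequent is a list (multiset, modulo the
-- exchange rule below) of formulae and structures ∘{Δ}, •{Δ}.
mutual
  data Item : Set where
    fml : Formula → Item
    wh  : Seq → Item
    bl  : Seq → Item

  Seq : Set
  Seq = List Item

data Dia : Set where
  dia pdia : Dia

diaF : Dia → Formula → Formula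
diaF dia  A = ◇ A
diaF pdia A = ◆ A

br : Dia → Seq → Item
br dia  Δ = wh Δ
br pdia Δ = bl Δ

-- Path axiom ⟨?⟩₁ ⋯ ⟨?⟩ₙ X → ⟨?⟩ X  (n ≥ 0)
record PathAxiom : Set where
  constructor _⇒_
  field
    prefix : List Dia
    target : Dia
open PathAxiom public

diaPrefix : List Dia → Formula → Formula
diaPrefix ds X = foldr diaF X ds

nest : List Dia → Seq → Seq
nest []       Δ = Δ
nest (d ∷ ds) Δ = [ br d (nest ds Δ) ]

-- Shallow calculus SKt, extended by a family of premise-free rules (Ax)
-- and a family of one-premise rules (Rl: Rl premise conclusion).
data SKt (Ax : Seq → Set) (Rl : Seq → Seq → Set) : Seq → Set where
  exch : ∀ {Γ Γ′} → Γ ↭ Γ′ → SKt Ax Rl Γ → SKt Ax Rl Γ′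
  id   : ∀ Γ a → SKt Ax Rl (Γ ++ fml (atom a) ∷ fml (natom a) ∷ [])
  cut  : ∀ {Γ} A → SKt Ax Rl (Γ ++ [ fml A ]) → SKt Ax Rl (Γ ++ [ fml (neg A) ])
       → SKt Ax Rl Γ
  andR : ∀ {Γ A B} → SKt Ax Rl (Γ ++ [ fml A ]) → SKt Ax Rl (Γ ++ [ fml B ])
       → SKt Ax Rl (Γ ++ [ fml (A ∧′ B) ])
  orR  : ∀ {Γ A B} → SKt Ax Rl (Γ ++ fml A ∷ fml B ∷ [])
       → SKt Ax Rl (Γ ++ [ fml (A ∨′ B) ])
  ctr  : ∀ {Γ Δ} → SKt Ax Rl (Γ ++ Δ ++ Δ) → SKt Ax Rl (Γ ++ Δ)
  wk   : ∀ {Γ} Δ → SKt Ax Rl Γ → SKt Ax Rl (Γ ++ Δ)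
  rf   : ∀ {Γ Δ} → SKt Ax Rl (Γ ++ [ wh Δ ]) → SKt Ax Rl (bl Γ ∷ Δ)
  rp   : ∀ {Γ Δ} → SKt Ax Rl (Γ ++ [ bl Δ ]) → SKt Ax Rl (wh Γ ∷ Δ)
  pboxR : ∀ {Γ A} → SKt Ax Rl (Γ ++ [ bl [ fml A ] ]) → SKt Ax Rl (Γ ++ [ fml (■ A) ])
  boxR  : ∀ {Γ A} → SKt Ax Rl (Γ ++ [ wh [ fml A ] ]) → SKt Ax Rl (Γ ++ [ fml (□ A) ])
  pdiaR : ∀ {Γ Δ A} → SKt Ax Rl (Γ ++ [ bl (Δ ++ [ fml A ]) ])
        → SKt Ax Rl (Γ ++ bl Δ ∷ fml (◆ A) ∷ [])
  diaR  : ∀ {Γ Δ A} → SKt Ax Rl (Γ ++ [ wh (Δ ++ [ fml A ]) ])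
        → SKt Ax Rl (Γ ++ wh Δ ∷ fml (◇ A) ∷ [])
  ax   : ∀ {Γ} → Ax Γ → SKt Ax Rl Γ
  rl   : ∀ {Γ Γ′} → Rl Γ Γ′ → SKt Ax Rl Γ → SKt Ax Rl Γ′

NoAx : Seq → Set
NoAx _ = ⊥

NoRl : Seq → Seq → Set
NoRl _ _ = ⊥

data AxRules (P : PathAxiom → Set) : Seq → Set where
  axInst : ∀ {ds d} → P (ds ⇒ d) → ∀ X →
           AxRules P (fml (neg (diaPrefix ds X)) ∷ fml (diaF d X) ∷ [])

data StrRules (P : PathAxiom → Set) : Seq → Seq → Set where
  strInst : ∀ {ds d} → P (ds ⇒ d) → ∀ Γ Δ →
            StrRules P (Γ ++ [ br d Δ ]) (Γ ++ nest ds Δ)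

SKt+Ax : (PathAxiom → Set) → Seq → Set
SKt+Ax P = SKt (AxRules P) NoRl

SKt+Str : (PathAxiom → Set) → Seq → Set
SKt+Str P = SKt NoAx (StrRules P)

module Submission where

open import Defs
open import Function.Bundles using (_⇔_; mk⇔)
open import Data.List using (List; []; _∷_; _++_; [_])
open import Data.List.Properties using (++-assoc; ++-identityʳ)
open import Data.List.Relation.Binary.Permutation.Propositional
  using (_↭_; refl; prep; swap; ↭-trans; ↭-reflexive)
open import Data.List.Relation.Binary.Permutation.Propositional.Properties
  using (++-comm; ++⁺ˡ)
open import Relation.Binary.PropositionalEquality using (_≡_; subst; sym; cong; cong₂)
  renaming (refl to ≡-refl; trans to ≡-trans)

-- A structural rule Γ, ⋆{Δ} / Γ, ⋆₁{⋯⋆ₙ{Δ}⋯} is admissible in SKt + AxP: fold ⋆{Δ}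
-- into the formula ⊡⟦Δ⟧, where ⊡ is the box of ⋆ and ⟦Δ⟧ the disjunction of Δ; the
-- axiom instance at X = ¬⟦Δ⟧ is ⊡₁⋯⊡ₙ⟦Δ⟧, ¬⊡⟦Δ⟧, whose boxes are invertible back into
-- the structures ⋆₁{⋯⋆ₙ{⟦Δ⟧}⋯}; cutting on ⊡⟦Δ⟧ and unfolding ⟦Δ⟧ gives the conclusion.
-- Conversely the axiom instance ¬(⟨?⟩₁⋯⟨?⟩ₙX), ⟨?⟩X is derived in SKt + P by applying the
-- structural rule to ⟨?⟩X, ⋆{¬X} and introducing the boxes. Derivations in one system are
-- then translated into the other rule by rule.

boxF : Dia → Formula → Formula
boxF dia  A = □ A
boxF pdia A = ■ A

boxPrefix : List Dia → Formula → Formula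
boxPrefix []       A = A
boxPrefix (d ∷ ds) A = boxF d (boxPrefix ds A)

neg-involutive : ∀ A → neg (neg A) ≡ A
neg-involutive (atom a)  = ≡-refl
neg-involutive (natom a) = ≡-refl
neg-involutive (A ∨′ B)  = cong₂ _∨′_ (neg-involutive A) (neg-involutive B)
neg-involutive (A ∧′ B)  = cong₂ _∧′_ (neg-involutive A) (neg-involutive B)
neg-involutive (□ A)     = cong □ (neg-involutive A)
neg-involutive (■ A)     = cong ■ (neg-involutive A)
neg-involutive (◇ A)     = cong ◇ (neg-involutive A)
neg-involutive (◆ A)     = cong ◆ (neg-involutive A)

neg-diaPrefix : ∀ ds X → neg (diaPrefix ds X) ≡ boxPrefix ds (neg X)
neg-diaPrefix []          X = ≡-refl
neg-diaPrefix (dia ∷ ds)  X = cong □ (neg-diaPrefix ds X)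
neg-diaPrefix (pdia ∷ ds) X = cong ■ (neg-diaPrefix ds X)

diaF-neg : ∀ d A → diaF d (neg A) ≡ neg (boxF d A)
diaF-neg dia  A = ≡-refl
diaF-neg pdia A = ≡-refl

falsum : Formula
falsum = atom 0 ∧′ natom 0

mutual
  ⟦_⟧ : Seq → Formula
  ⟦ [] ⟧    = falsum
  ⟦ x ∷ Δ ⟧ = ⟦ x ⟧ᵢ ∨′ ⟦ Δ ⟧

  ⟦_⟧ᵢ : Item → Formula
  ⟦ fml A ⟧ᵢ = A
  ⟦ wh Δ ⟧ᵢ  = □ ⟦ Δ ⟧
  ⟦ bl Δ ⟧ᵢ  = ■ ⟦ Δ ⟧

swap-suffixes : ∀ (Γ Δ Λ : Seq) → (Γ ++ Δ) ++ Λ ↭ (Γ ++ Λ) ++ Δ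
swap-suffixes Γ Δ Λ = ↭-trans (↭-reflexive (++-assoc Γ Δ Λ))
  (↭-trans (++⁺ˡ Γ (++-comm Δ Λ)) (↭-reflexive (sym (++-assoc Γ Λ Δ))))

module DerivedRules {Ax : Seq → Set} {Rl : Seq → Seq → Set} where

  private
    S : Seq → Set
    S = SKt Ax Rl

  exch-swap : ∀ {x y Γ} → S (x ∷ y ∷ Γ) → S (y ∷ x ∷ Γ)
  exch-swap = exch (swap _ _ refl)

  cut-split : ∀ {Γ Δ} A → S (Γ ++ [ fml A ]) → S (Δ ++ [ fml (neg A) ]) → S (Γ ++ Δ)
  cut-split {Γ} {Δ} A p q = cut A
    (exch (swap-suffixes Γ [ fml A ] Δ) (wk Δ p))
    (exch (↭-trans (++-comm (Δ ++ _) Γ) (↭-reflexive (sym (++-assoc Γ Δ _)))) (wk Γ q))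

  br-intro : ∀ d {Σ} → S Σ → S [ br d Σ ]
  br-intro dia  {Σ} p = rp {Γ = Σ} {Δ = []} (wk [ bl [] ] p)
  br-intro pdia {Σ} p = rf {Γ = Σ} {Δ = []} (wk [ wh [] ] p)

  box-intro : ∀ d Γ A → S (Γ ++ [ br d [ fml A ] ]) → S (Γ ++ [ fml (boxF d A) ])
  box-intro dia  Γ A = boxR
  box-intro pdia Γ A = pboxR

  dia-intro : ∀ d {Δ A} → S (Δ ++ [ fml A ]) → S (br d Δ ∷ fml (diaF d A) ∷ [])
  dia-intro dia  {Δ} p = diaR {Γ = []} {Δ = Δ} (br-intro dia p)
  dia-intro pdia {Δ} p = pdiaR {Γ = []} {Δ = Δ} (br-intro pdia p)

  dia-box-intro : ∀ d {A B} → S (fml A ∷ fml B ∷ []) → S (fml (diaF d A) ∷ fml (boxF d B) ∷ [])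
  dia-box-intro d {A} p = box-intro d [ fml (diaF d A) ] _ (exch-swap (dia-intro d (exch-swap p)))

  and-or-intro : ∀ {A B C D} → S (fml A ∷ fml C ∷ []) → S (fml B ∷ fml D ∷ [])
               → S (fml (A ∧′ B) ∷ fml (C ∨′ D) ∷ [])
  and-or-intro {A} {B} {C} {D} p q = exch-swap (andR {Γ = [ fml (C ∨′ D) ]}
    (exch-swap (orR {Γ = [ fml A ]} (wk [ fml D ] p)))
    (exch-swap (orR {Γ = [ fml B ]} (exch (prep _ (swap _ _ refl)) (wk [ fml C ] q)))))

  identity : ∀ A → S (fml (neg A) ∷ fml A ∷ [])
  identity (atom a)  = exch-swap (id [] a)
  identity (natom a) = id [] a
  identity (A ∨′ B)  = and-or-intro (identity A) (identity B)
  identity (A ∧′ B)  = exch-swap (and-or-intro (exch-swap (identity A)) (exch-swap (identity B)))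
  identity (□ A)     = dia-box-intro dia (identity A)
  identity (■ A)     = dia-box-intro pdia (identity A)
  identity (◇ A)     = exch-swap (dia-box-intro dia (exch-swap (identity A)))
  identity (◆ A)     = exch-swap (dia-box-intro pdia (exch-swap (identity A)))

  -- Display ⋆{Σ} with rf/rp so that Σ becomes the context's right end, apply h, undisplay.
  under-br : ∀ {Σ Σ′} → (∀ Γ → S (Γ ++ Σ) → S (Γ ++ Σ′))
           → ∀ d Γ → S (Γ ++ [ br d Σ ]) → S (Γ ++ [ br d Σ′ ])
  under-br {Σ} {Σ′} h dia Γ p = exch (++-comm [ wh Σ′ ] Γ)
    (rp {Γ = Σ′} {Δ = Γ} (exch (++-comm [ bl Γ ] Σ′) (h [ bl Γ ] (rf {Γ = Γ} {Δ = Σ} p))))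
  under-br {Σ} {Σ′} h pdia Γ p = exch (++-comm [ bl Σ′ ] Γ)
    (rf {Γ = Σ′} {Δ = Γ} (exch (++-comm [ wh Γ ] Σ′) (h [ wh Γ ] (rp {Γ = Γ} {Δ = Σ} p))))

  under-nest : ∀ {Σ Σ′} → (∀ Γ → S (Γ ++ Σ) → S (Γ ++ Σ′))
             → ∀ ds Γ → S (Γ ++ nest ds Σ) → S (Γ ++ nest ds Σ′)
  under-nest h []       = h
  under-nest h (d ∷ ds) = under-br (under-nest h ds) d

  boxes-intro : ∀ ds A Γ → S (Γ ++ nest ds [ fml A ]) → S (Γ ++ [ fml (boxPrefix ds A) ])
  boxes-intro []       A Γ p = p
  boxes-intro (d ∷ ds) A Γ p = box-intro d Γ _ (under-br (boxes-intro ds A) d Γ p)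

  box-inv : ∀ d A Γ → S (Γ ++ [ fml (boxF d A) ]) → S (Γ ++ [ br d [ fml A ] ])
  box-inv d A Γ p = cut-split (boxF d A) p
    (subst (λ F → S (br d [ fml A ] ∷ fml F ∷ [])) (diaF-neg d A)
      (dia-intro d (exch-swap (identity A))))

  boxes-inv : ∀ ds A Γ → S (Γ ++ [ fml (boxPrefix ds A) ]) → S (Γ ++ nest ds [ fml A ])
  boxes-inv []       A Γ p = p
  boxes-inv (d ∷ ds) A Γ p = under-br (boxes-inv ds A) d Γ (box-inv d _ Γ p)

  mutual
    ⟦⟧-intro : ∀ Δ Θ → S (Θ ++ Δ) → S (Θ ++ [ fml ⟦ Δ ⟧ ])
    ⟦⟧-intro []      Θ p = wk [ fml falsum ] (subst S (++-identityʳ Θ) p)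
    ⟦⟧-intro (x ∷ Δ) Θ p = orR {Γ = Θ} (subst S (++-assoc Θ _ _)
        (exch (swap-suffixes Θ _ _) (⟦⟧ᵢ-intro x (Θ ++ [ fml ⟦ Δ ⟧ ]) Δ-folded)))
      where
      Δ-folded : S ((Θ ++ [ fml ⟦ Δ ⟧ ]) ++ [ x ])
      Δ-folded = exch (swap-suffixes Θ _ _)
        (⟦⟧-intro Δ (Θ ++ [ x ]) (subst S (sym (++-assoc Θ [ x ] Δ)) p))

    ⟦⟧ᵢ-intro : ∀ x Θ → S (Θ ++ [ x ]) → S (Θ ++ [ fml ⟦ x ⟧ᵢ ])
    ⟦⟧ᵢ-intro (fml A) Θ p = p
    ⟦⟧ᵢ-intro (wh Δ)  Θ p = boxR (under-br (⟦⟧-intro Δ) dia Θ p)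
    ⟦⟧ᵢ-intro (bl Δ)  Θ p = pboxR (under-br (⟦⟧-intro Δ) pdia Θ p)

  mutual
    ⟦⟧-identity : ∀ Δ → S (Δ ++ [ fml (neg ⟦ Δ ⟧) ])
    ⟦⟧-identity []      = orR {Γ = []} (identity (atom 0))
    ⟦⟧-identity (x ∷ Δ) = andR {Γ = x ∷ Δ}
      (exch (prep x (++-comm [ fml (neg ⟦ x ⟧ᵢ) ] Δ)) (wk Δ (exch-swap (⟦⟧ᵢ-identity x))))
      (exch (++-comm (Δ ++ _) [ x ]) (wk [ x ] (⟦⟧-identity Δ)))

    ⟦⟧ᵢ-identity : ∀ x → S (fml (neg ⟦ x ⟧ᵢ) ∷ x ∷ [])
    ⟦⟧ᵢ-identity (fml A) = identity A
    ⟦⟧ᵢ-identity (wh Δ)  = exch-swap (dia-intro dia (⟦⟧-identity Δ))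
    ⟦⟧ᵢ-identity (bl Δ)  = exch-swap (dia-intro pdia (⟦⟧-identity Δ))

  ⟦⟧-elim : ∀ Δ Θ → S (Θ ++ [ fml ⟦ Δ ⟧ ]) → S (Θ ++ Δ)
  ⟦⟧-elim Δ Θ p = cut-split ⟦ Δ ⟧ p (⟦⟧-identity Δ)

  simulate : ∀ {Ax′ Rl′}
           → (∀ {Γ} → Ax Γ → SKt Ax′ Rl′ Γ)
           → (∀ {Γ Γ′} → Rl Γ Γ′ → SKt Ax′ Rl′ Γ → SKt Ax′ Rl′ Γ′)
           → ∀ {Γ} → S Γ → SKt Ax′ Rl′ Γ
  simulate f g (exch π p)       = exch π (simulate f g p)
  simulate f g (id Γ a)         = id Γ a
  simulate f g (cut {Γ} A p q)  = cut {Γ = Γ} A (simulate f g p) (simulate f g q)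
  simulate f g (andR {Γ} p q)   = andR {Γ = Γ} (simulate f g p) (simulate f g q)
  simulate f g (orR {Γ} p)      = orR {Γ = Γ} (simulate f g p)
  simulate f g (ctr {Γ} {Δ} p)  = ctr {Γ = Γ} {Δ = Δ} (simulate f g p)
  simulate f g (wk {Γ} Δ p)     = wk {Γ = Γ} Δ (simulate f g p)
  simulate f g (rf {Γ} {Δ} p)   = rf {Γ = Γ} {Δ = Δ} (simulate f g p)
  simulate f g (rp {Γ} {Δ} p)   = rp {Γ = Γ} {Δ = Δ} (simulate f g p)
  simulate f g (pboxR {Γ} p)    = pboxR {Γ = Γ} (simulate f g p)
  simulate f g (boxR {Γ} p)     = boxR {Γ = Γ} (simulate f g p)
  simulate f g (pdiaR {Γ} {Δ} p) = pdiaR {Γ = Γ} {Δ = Δ} (simulate f g p)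
  simulate f g (diaR {Γ} {Δ} p) = diaR {Γ = Γ} {Δ = Δ} (simulate f g p)
  simulate f g (ax a)           = f a
  simulate f g (rl r p)         = g r (simulate f g p)

open DerivedRules

module _ (P : PathAxiom → Set) where

  axiom-dual : ∀ {ds d} → P (ds ⇒ d) → ∀ D
             → SKt+Ax P (fml (boxPrefix ds D) ∷ fml (neg (boxF d D)) ∷ [])
  axiom-dual {ds} {d} pr D = subst₂-fml
    (≡-trans (neg-diaPrefix ds (neg D)) (cong (boxPrefix ds) (neg-involutive D)))
    (diaF-neg d D)
    (ax (axInst pr (neg D)))
    where
    subst₂-fml : ∀ {A A′ B B′} → A ≡ A′ → B ≡ B′
               → SKt+Ax P (fml A ∷ fml B ∷ []) → SKt+Ax P (fml A′ ∷ fml B′ ∷ [])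
    subst₂-fml ≡-refl ≡-refl p = p

  structural-admissible : ∀ {Γ Γ′} → StrRules P Γ Γ′ → SKt+Ax P Γ → SKt+Ax P Γ′
  structural-admissible (strInst {ds} {d} pr Γ Δ) p =
    under-nest (⟦⟧-elim Δ) ds Γ (cut-split (boxF d ⟦ Δ ⟧) boxed boxes-dual)
    where
    boxed : SKt+Ax P (Γ ++ [ fml (boxF d ⟦ Δ ⟧) ])
    boxed = box-intro d Γ _ (under-br (⟦⟧-intro Δ) d Γ p)
    boxes-dual : SKt+Ax P (nest ds [ fml ⟦ Δ ⟧ ] ++ [ fml (neg (boxF d ⟦ Δ ⟧)) ])
    boxes-dual = exch (++-comm [ fml _ ] (nest ds _))
      (boxes-inv ds ⟦ Δ ⟧ [ fml _ ] (exch-swap (axiom-dual pr ⟦ Δ ⟧)))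

  axiom-derivable : ∀ {Γ} → AxRules P Γ → SKt+Str P Γ
  axiom-derivable (axInst {ds} {d} pr X) =
    exch-swap (subst (λ F → SKt+Str P (fml (diaF d X) ∷ fml F ∷ [])) (sym (neg-diaPrefix ds X))
      (boxes-intro ds (neg X) [ fml (diaF d X) ]
        (rl (strInst pr [ fml (diaF d X) ] [ fml (neg X) ])
          (exch-swap (dia-intro d (identity X))))))

proposition6p2 : (P : PathAxiom → Set) → (Γ : Seq) → SKt+Ax P Γ ⇔ SKt+Str P Γ
proposition6p2 P Γ = mk⇔
  (simulate (axiom-derivable P) (λ ()))
  (simulate (λ ()) (structural-admissible P))
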